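{- Let $r,p,q,n,k$ be positive integers with $p\mid r$, $q\mid r$, $pq\mid rn$, $G=G(r,p,q,n)$, and let $A$ be a $k\times n$ matrix of nonnegative integers whose row sums are divisible by $q$; let $s_j$ be the sum of the entries in its $j$-th column. Then $(\mathcal X^A)^{\#}\ne0$ if and only if (1) $s_i\equiv s_j\pmod r$ for all $i,j$, and (2) $ps_i\equiv0\pmod r$ for all $i$.
   Context: $\zeta_m=e^{2\pi i/m}$; $G(r,n)$ is the group of $n\times n$ monomial matrices with $r$-th roots of unity as nonzero entries; $g=[\sigma;c_1,\ldots,c_n]$ means row $i$ has entry $\zeta_r^{c_i}$ in column $\sigma(i)$. $G(r,p,n)=\{[\sigma;c]:\sum c_i\equiv0\bmod p\}$ and $G=G(r,p,n)/\langle\zeta_qI\rangle$. $G(r,p,n)$ acts on polynomials in variables $x_{i,1},\ldots,x_{i,n}$ by $[\sigma;c]:x_{i,j}\mapsto\zeta_r^{c_j}x_{i,\sigma(j)}$; this induces an action of $G$ on $S_q[X_1,\ldots,X_k]$, the span of monomials in $x_{i,j}$ ($i\in[k],j\in[n]$) whose degree in $x_{i,1},\ldots,x_{i,n}$ is divisible by $q$ for each $i$, with $g$ acting simultaneously on all $k$ sets of variables (diagonal action $\Delta G$). $\mathcal X^A=\prod_{i,j}x_{i,j}^{a_{i,j}}$ and $F^{\#}=\frac1{|G|}\sum_{g\in\Delta G}g(F)$. -}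

module Defs where

open import Level using (Level; _⊔_)
open import Algebra.Bundles using (CommutativeRing)
import Algebra.Bundles
import Algebra.Definitions.RawSemiring as RawSemiringDefs
open import Data.Nat as ℕ using (ℕ; zero; suc; _<_)
open import Data.Nat.Divisibility using (_∣?_)
open import Data.Fin as Fin using (Fin; toℕ)
open import Data.Vec as Vec using (Vec; []; _∷_; lookup; tabulate; toList)
open import Data.Vec.Properties using (≡-dec)
open import Data.List as List using (List; []; _∷_; map; concatMap; filter; length; foldr)
open import Data.List.Relation.Unary.Unique.Propositional using (Unique)
import Data.List.Relation.Unary.Unique.DecPropositional as UniqueDec
open import Data.Nat.ListAction using (sum)
open import Data.Product using (Σ; ∃; _,_; proj₁; proj₂)
open import Relation.Nullary using (¬_; does; _×-dec_)
open import Relation.Binary.PropositionalEquality using (_≡_)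
open import Data.Bool using (if_then_else_)

record CharZeroField c ℓ : Set (Level.suc (c ⊔ ℓ)) where
  field
    commRing : CommutativeRing c ℓ
  open CommutativeRing commRing public
  open RawSemiringDefs (Algebra.Bundles.Semiring.rawSemiring semiring) public using (_^_) renaming (_×_ to _·1×_)
  field
    _⁻¹        : Carrier → Carrier
    ⁻¹-inverse : ∀ x → ¬ (x ≈ 0#) → (x * (x ⁻¹)) ≈ 1#
    ⁻¹-zero    : (0# ⁻¹) ≈ 0#
    char0      : ∀ m → ¬ ((suc m ·1× 1#) ≈ 0#)

IsPrimitiveRoot : ∀ {c ℓ} (K : CharZeroField c ℓ) → ℕ → CharZeroField.Carrier K → Set ℓ
IsPrimitiveRoot K r ζ =
  Data.Product._×_ ((ζ ^ r) ≈ 1#) (∀ m → 0 < m → m < r → ¬ ((ζ ^ m) ≈ 1#))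
  where open CharZeroField K

ΣFin : ∀ n → (Fin n → ℕ) → ℕ
ΣFin n f = sum (map f (List.allFin n))

allVecs : (m n : ℕ) → List (Vec (Fin m) n)
allVecs m zero    = [] ∷ []
allVecs m (suc n) = concatMap (λ x → map (x ∷_) (allVecs m n)) (List.allFin m)

-- Exponent matrices: A : Exp k n, entry (i , j) = exponent of x_{i,j}.

Exp : ℕ → ℕ → Set
Exp k n = Vec (Vec ℕ n) k

entry : ∀ {k n} → Exp k n → Fin k → Fin n → ℕ
entry A i j = lookup (lookup A i) j

colSum : ∀ {k n} → Exp k n → Fin n → ℕ
colSum {k} A j = ΣFin k (λ i → entry A i j)

rowSum : ∀ {k n} → Exp k n → Fin k → ℕ
rowSum {k} {n} A i = ΣFin n (λ j → entry A i j)

-- Elements [σ ; c] of G(r,n): σ a permutation of Fin n (an injective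
-- vector of images), c ∈ (ℤ/r)^n.  Row i has ζ_r^{c_i} in column σ(i).

record Mono (r n : ℕ) : Set where
  constructor [_︔_]
  field
    σ : Vec (Fin n) n
    c : Vec (Fin r) n

G[_,_,_] : (r p n : ℕ) → List (Mono r n)
G[ r , p , n ] =
  concatMap (λ σ → map (λ c → [ σ ︔ c ])
                       (filter (λ c → p ∣? sum (map toℕ (toList c))) (allVecs r n)))
            (filter (λ σ → UniqueDec.unique? (Fin._≟_ {n}) (toList σ)) (allVecs n n))

-- Polynomials over K in the variables x_{i,j} (i < k, j < n), as finite
-- formal sums of terms (coefficient , exponent matrix).

module Poly {c ℓ} (K : CharZeroField c ℓ) (k n : ℕ) where
  open CharZeroField K

  Polynomial : Set c
  Polynomial = List (Data.Product._×_ Carrier (Exp k n))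

  𝒳^ : Exp k n → Polynomial
  𝒳^ A = (1# , A) ∷ []

  coeff : Exp k n → Polynomial → Carrier
  coeff B = foldr (λ t acc → if does (≡-dec (≡-dec ℕ._≟_) (proj₂ t) B)
                               then proj₁ t + acc else acc) 0#

  NonZeroPoly : Polynomial → Set ℓ
  NonZeroPoly F = ∃ λ B → ¬ (coeff B F ≈ 0#)

  scale : Carrier → Polynomial → Polynomial
  scale a = map (λ t → (a * proj₁ t , proj₂ t))

  module Action (r : ℕ) (ζ : Carrier) where
    -- [σ;c] : x_{i,j} ↦ ζ^{c_j} x_{i,σ(j)}, applied to a term a·𝒳^A:
    -- a · ∏_{i,j} (ζ^{c_j} x_{i,σ(j)})^{a_{i,j}}
    --   = (a · ζ^{Σ_{i,j} c_j a_{i,j}}) · ∏_{i,j'} x_{i,j'}^{Σ_{j : σ j = j'} a_{i,j}}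
    actTerm : Mono r n → Data.Product._×_ Carrier (Exp k n)
                       → Data.Product._×_ Carrier (Exp k n)
    actTerm [ σ ︔ c ] (a , A) =
      ( a * (ζ ^ ΣFin k (λ i → ΣFin n (λ j → toℕ (lookup c j) ℕ.* entry A i j)))
      , tabulate (λ i → tabulate (λ j' →
          ΣFin n (λ j → if does (lookup σ j Fin.≟ j') then entry A i j else 0))) )

    act : Mono r n → Polynomial → Polynomial
    act g = map (actTerm g)

    -- F^# = (1/|G|) Σ_{g} g(F), averaging over the (diagonal) action of
    -- G(r,p,n) (on S_q this equals the average over
    -- G(r,p,q,n) = G(r,p,n)/⟨ζ_q I⟩).
    avg : (p : ℕ) → Polynomial → Polynomial
    avg p F = scale ((length G[ r , p , n ] ·1× 1#) ⁻¹)
                    (concatMap (λ g → act g F) G[ r , p , n ])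

{-# OPTIONS --safe #-}
-- Expanding the average, the coefficient of 𝒳^B in (𝒳^A)^# is |G|⁻¹ times the number
-- of permutations σ carrying A to B times the character sum
--   S = Σ_c ζ^⟨c,s⟩,   c ∈ (ℤ/r)^n with p ∣ Σ_j c_j,   ⟨c,s⟩ = Σ_j c_j s_j,
-- where s is the vector of column sums.  Taking B = A (σ = id) shows (𝒳^A)^# ≠ 0 iff S ≠ 0.
-- Translating c by an admissible h permutes the admissible vectors and multiplies S by
-- ζ^⟨h,s⟩, so S = 0 unless r ∣ ⟨h,s⟩ for every admissible h; the test vectors
-- e_i + (r−1)e_j and p·e_i turn this into conditions (1) and (2).  Conversely, under (1)
-- and (2) every term of S equals 1, so S is a positive integer, nonzero in characteristic 0.

module Submission where

open import Defs

open import Data.Nat as ℕ using (ℕ; zero; suc; NonZero; _%_)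
open import Data.Nat.Divisibility
  using (_∣_; _∣?_; m%n≡0⇒n∣m; n∣m⇒m%n≡0; ∣-refl; ∣m+n∣m⇒∣n; ∣m∣n⇒∣m+n; _∣0)
open import Data.Nat.DivMod using (_/_; m≡m%n+[m/n]*n; m%n<n)
import Data.Nat.Properties as ℕ
open import Data.Product using (_×_; _,_; proj₁; proj₂)
import Data.Nat.ListAction as ℕ
open import Data.Fin as Fin using (Fin; toℕ) renaming (zero to 0F; suc to 1+)
open import Data.Vec as Vec using (Vec; []; _∷_; lookup; toList; zipWith)
open import Data.List as List using (List; []; _∷_; map; allFin; filter; concatMap; length)
open import Data.List.Relation.Unary.Any as Any using (here)
open import Data.List.Membership.Propositional.Properties
  using (∈-map⁺; ∈-concatMap⁺; ∈-filter⁺; ∈-allFin)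
open import Data.List.Membership.Propositional using (_∈_)
open import Relation.Unary using (Decidable)
open import Data.List.Relation.Unary.Unique.Propositional using (Unique)
open import Data.List.Relation.Unary.Unique.Propositional.Properties using (allFin⁺)
import Data.List.Relation.Unary.Unique.DecPropositional as UniqueDec
open import Data.Vec.Properties using (tabulate-cong; tabulate∘lookup; lookup∘tabulate; ≡-dec)
open import Relation.Binary.Definitions using (DecidableEquality)
open import Data.Bool using (true; false; if_then_else_)
open import Function using (_∘_; id)
open import Relation.Nullary using (does; yes; no; ¬_; contradiction)
open import Relation.Nullary.Decidable using (decidable-stable)
open import Relation.Binary.PropositionalEquality using (_≡_; _≗_; module ≡-Reasoning)
import Relation.Binary.PropositionalEquality as ≡
open import Function.Bundles using (_⇔_; mk⇔)
open import Function.Properties.Equivalence using () renaming (trans to ⇔-trans)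

module _ where
  open import Data.Nat using (_+_; _*_)
  open import Data.Nat.Properties using (+-*-semiring; +-identityʳ; *-distribʳ-+)
  open import Data.List.Properties using (map-tabulate; map-cong)
  import Algebra.Properties.Semiring.Sum +-*-semiring as ℕΣ

  ΣFin-suc : ∀ n (f : Fin (suc n) → ℕ) → ΣFin (suc n) f ≡ f 0F + ΣFin n (f ∘ 1+)
  ΣFin-suc n f = ≡.cong (λ xs → f 0F + ℕ.sum xs)
    (≡.trans (map-tabulate 1+ f) (≡.sym (map-tabulate id (f ∘ 1+))))

  ΣFin≡sum : ∀ n (f : Fin n → ℕ) → ΣFin n f ≡ ℕΣ.sum f
  ΣFin≡sum zero    f = ≡.refl
  ΣFin≡sum (suc n) f = ≡.trans (ΣFin-suc n f) (≡.cong (f 0F +_) (ΣFin≡sum n (f ∘ 1+)))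

  ΣFin-cong : ∀ n {f g : Fin n → ℕ} → f ≗ g → ΣFin n f ≡ ΣFin n g
  ΣFin-cong n f≗g = ≡.cong ℕ.sum (map-cong f≗g (allFin n))

  ΣFin-distrib-+ : ∀ n (f g : Fin n → ℕ) → ΣFin n (λ j → f j + g j) ≡ ΣFin n f + ΣFin n g
  ΣFin-distrib-+ n f g = begin
    ΣFin n (λ j → f j + g j)        ≡⟨ ΣFin≡sum n _ ⟩
    ℕΣ.sum (λ j → f j + g j)        ≡⟨ ℕΣ.∑-distrib-+ f g ⟩
    ℕΣ.sum f + ℕΣ.sum g             ≡⟨ ≡.sym (≡.cong₂ _+_ (ΣFin≡sum n f) (ΣFin≡sum n g)) ⟩
    ΣFin n f + ΣFin n g             ∎
    where open ≡-Reasoning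

  ΣFin-comm : ∀ m n (f : Fin m → Fin n → ℕ) →
              ΣFin m (λ i → ΣFin n (f i)) ≡ ΣFin n (λ j → ΣFin m (λ i → f i j))
  ΣFin-comm m n f = begin
    ΣFin m (λ i → ΣFin n (f i))          ≡⟨ ΣFin≡sum m _ ⟩
    ℕΣ.sum (λ i → ΣFin n (f i))          ≡⟨ ℕΣ.sum-cong-≗ (λ i → ΣFin≡sum n (f i)) ⟩
    ℕΣ.sum (λ i → ℕΣ.sum (f i))          ≡⟨ ℕΣ.∑-comm f ⟩
    ℕΣ.sum (λ j → ℕΣ.sum (λ i → f i j))  ≡⟨ ℕΣ.sum-cong-≗ (λ j → ΣFin≡sum m (λ i → f i j)) ⟨
    ℕΣ.sum (λ j → ΣFin m (λ i → f i j))  ≡⟨ ≡.sym (ΣFin≡sum n _) ⟩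
    ΣFin n (λ j → ΣFin m (λ i → f i j))  ∎
    where open ≡-Reasoning

  *-distribˡ-ΣFin : ∀ n a (f : Fin n → ℕ) → a * ΣFin n f ≡ ΣFin n (λ j → a * f j)
  *-distribˡ-ΣFin n a f = begin
    a * ΣFin n f                ≡⟨ ≡.cong (a *_) (ΣFin≡sum n f) ⟩
    a * ℕΣ.sum f                ≡⟨ ℕΣ.*-distribˡ-sum a f ⟩
    ℕΣ.sum (λ j → a * f j)      ≡⟨ ≡.sym (ΣFin≡sum n _) ⟩
    ΣFin n (λ j → a * f j)      ∎
    where open ≡-Reasoning

  *-distribʳ-ΣFin : ∀ n a (f : Fin n → ℕ) → ΣFin n f * a ≡ ΣFin n (λ j → f j * a)
  *-distribʳ-ΣFin n a f = begin
    ΣFin n f * a                ≡⟨ ≡.cong (_* a) (ΣFin≡sum n f) ⟩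
    ℕΣ.sum f * a                ≡⟨ ℕΣ.*-distribʳ-sum a f ⟩
    ℕΣ.sum (λ j → f j * a)      ≡⟨ ≡.sym (ΣFin≡sum n _) ⟩
    ΣFin n (λ j → f j * a)      ∎
    where open ≡-Reasoning

  ΣFin-indicator : ∀ n (i : Fin n) (f : Fin n → ℕ) →
                   ΣFin n (λ j → if does (j Fin.≟ i) then f j else 0) ≡ f i
  ΣFin-indicator (suc n) 0F f = begin
    ΣFin (suc n) (λ j → if does (j Fin.≟ 0F) then f j else 0)
      ≡⟨ ΣFin-suc n _ ⟩
    f 0F + ΣFin n (λ _ → 0)
      ≡⟨ ≡.cong (f 0F +_) (≡.trans (ΣFin≡sum n _) (ℕΣ.sum-replicate-zero n)) ⟩
    f 0F + 0
      ≡⟨ +-identityʳ (f 0F) ⟩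
    f 0F ∎
    where open ≡-Reasoning
  ΣFin-indicator (suc n) (1+ i) f =
    ≡.trans (ΣFin-suc n (λ j → if does (j Fin.≟ 1+ i) then f j else 0)) (ΣFin-indicator n i (f ∘ 1+))

  single : ∀ {n} → Fin n → ℕ → Fin n → ℕ
  single i a j = if does (j Fin.≟ i) then a else 0

  ΣFin-single : ∀ n (i : Fin n) a → ΣFin n (single i a) ≡ a
  ΣFin-single n i a = ΣFin-indicator n i (λ _ → a)

  ΣFin-single-* : ∀ n (i : Fin n) a (s : Fin n → ℕ) → ΣFin n (λ j → single i a j * s j) ≡ a * s i
  ΣFin-single-* n i a s =
    ≡.trans (ΣFin-cong n (λ j → if-* (does (j Fin.≟ i)) (s j))) (ΣFin-indicator n i (λ j → a * s j))
    where
    if-* : ∀ b x → (if b then a else 0) * x ≡ (if b then a * x else 0)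
    if-* true  x = ≡.refl
    if-* false x = ≡.refl

  ΣFin-single+single : ∀ n (i j : Fin n) a b → ΣFin n (λ t → single i a t + single j b t) ≡ a + b
  ΣFin-single+single n i j a b =
    ≡.trans (ΣFin-distrib-+ n (single i a) (single j b))
            (≡.cong₂ _+_ (ΣFin-single n i a) (ΣFin-single n j b))

  ΣFin-[single+single]* : ∀ n (i j : Fin n) a b (s : Fin n → ℕ) →
                          ΣFin n (λ t → (single i a t + single j b t) * s t) ≡ a * s i + b * s j
  ΣFin-[single+single]* n i j a b s = begin
    ΣFin n (λ t → (single i a t + single j b t) * s t)
      ≡⟨ ΣFin-cong n (λ t → *-distribʳ-+ (s t) (single i a t) (single j b t)) ⟩
    ΣFin n (λ t → single i a t * s t + single j b t * s t)
      ≡⟨ ΣFin-distrib-+ n _ _ ⟩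
    ΣFin n (λ t → single i a t * s t) + ΣFin n (λ t → single j b t * s t)
      ≡⟨ ≡.cong₂ _+_ (ΣFin-single-* n i a s) (ΣFin-single-* n j b s) ⟩
    a * s i + b * s j ∎
    where open ≡-Reasoning

∈-allVecs : ∀ m n (v : Vec (Fin m) n) → v ∈ allVecs m n
∈-allVecs m zero    []      = here ≡.refl
∈-allVecs m (suc n) (x ∷ v) = ∈-concatMap⁺ (λ y → map (y ∷_) (allVecs m n))
    (Any.map (λ { ≡.refl → ∈-map⁺ (x ∷_) (∈-allVecs m n v) }) (∈-allFin x))

toList-tabulate : ∀ {a} {X : Set a} {m} (f : Fin m → X) → toList (Vec.tabulate f) ≡ List.tabulate f
toList-tabulate {m = zero}  f = ≡.refl
toList-tabulate {m = suc m} f = ≡.cong (f 0F ∷_) (toList-tabulate (f ∘ 1+))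

permutations : ∀ n → List (Vec (Fin n) n)
permutations n = filter (λ σ → UniqueDec.unique? Fin._≟_ (toList σ)) (allVecs n n)

ι : ∀ {n} → Vec (Fin n) n
ι = Vec.tabulate id

ι∈permutations : ∀ n → ι ∈ permutations n
ι∈permutations n = ∈-filter⁺ (λ σ → UniqueDec.unique? Fin._≟_ (toList σ)) (∈-allVecs n n ι)
  (≡.subst Unique (≡.sym (toList-tabulate id)) (allFin⁺ n))

-- The exponent matrix of actTerm [ σ ︔ c ] (1# , A); it does not depend on c.
infixr 5 _⊙_

_⊙_ : ∀ {k n} → Vec (Fin n) n → Exp k n → Exp k n
_⊙_ {n = n} σ A = Vec.tabulate (λ i → Vec.tabulate (λ j′ →
  ΣFin n (λ j → if does (lookup σ j Fin.≟ j′) then entry A i j else 0)))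

ι⊙A≡A : ∀ {k n} (A : Exp k n) → ι ⊙ A ≡ A
ι⊙A≡A {n = n} A = ≡.trans
  (tabulate-cong λ i → ≡.trans (tabulate-cong (entry≡ i)) (tabulate∘lookup (lookup A i)))
  (tabulate∘lookup A)
  where
  entry≡ : ∀ i j′ → ΣFin n (λ j → if does (lookup ι j Fin.≟ j′) then entry A i j else 0)
                   ≡ entry A i j′
  entry≡ i j′ = ≡.trans
    (ΣFin-cong n λ j → ≡.cong (λ x → if does (x Fin.≟ j′) then entry A i j else 0)
                              (lookup∘tabulate id j))
    (ΣFin-indicator n j′ (entry A i))

module Modular (r : ℕ) .{{_ : NonZero r}} where
  open import Data.Nat using (_+_; _*_; _∸_; pred)
  open import Data.Nat.Properties
    using (+-comm; +-assoc; *-comm; *-distribʳ-+; suc-pred; m+[n∸m]≡n; <⇒≤; +-commutativeSemigroup)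
  open import Data.Nat.DivMod
    using ( _mod_; %-distribˡ-+; %-distribˡ-*; m%n%n≡m%n; m<n⇒m%n≡m; m%n<n; n%n≡0
          ; [m+n]%n≡m%n; [m+kn]%n≡m%n; %-remove-+ˡ)
  open import Data.Nat.Divisibility using (∣n∣m%n⇒∣m; %-presˡ-∣; _∣0; ∣-refl; ∣-trans; *-monoˡ-∣)
  open import Data.Fin.Properties using (toℕ-fromℕ<; toℕ-injective; toℕ<n)
  open import Data.Fin.Permutation using (Permutation; permutation)
  open import Data.Vec.Properties using (lookup-zipWith)
  open import Algebra.Properties.CommutativeSemigroup +-commutativeSemigroup using (interchange)

  %-cong-+ : ∀ {a a′ b b′} → a % r ≡ a′ % r → b % r ≡ b′ % r → (a + b) % r ≡ (a′ + b′) % r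
  %-cong-+ {a} {a′} {b} {b′} a≡a′ b≡b′ = begin
    (a + b) % r              ≡⟨ %-distribˡ-+ a b r ⟩
    (a % r + b % r) % r      ≡⟨ ≡.cong₂ (λ x y → (x + y) % r) a≡a′ b≡b′ ⟩
    (a′ % r + b′ % r) % r    ≡⟨ %-distribˡ-+ a′ b′ r ⟨
    (a′ + b′) % r            ∎
    where open ≡-Reasoning

  %-cong-* : ∀ {a a′ b b′} → a % r ≡ a′ % r → b % r ≡ b′ % r → (a * b) % r ≡ (a′ * b′) % r
  %-cong-* {a} {a′} {b} {b′} a≡a′ b≡b′ = begin
    (a * b) % r              ≡⟨ %-distribˡ-* a b r ⟩
    (a % r * (b % r)) % r    ≡⟨ ≡.cong₂ (λ x y → (x * y) % r) a≡a′ b≡b′ ⟩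
    (a′ % r * (b′ % r)) % r  ≡⟨ %-distribˡ-* a′ b′ r ⟨
    (a′ * b′) % r            ∎
    where open ≡-Reasoning

  ΣFin-cong-% : ∀ n {f g : Fin n → ℕ} → (∀ j → f j % r ≡ g j % r) → ΣFin n f % r ≡ ΣFin n g % r
  ΣFin-cong-% zero    f≡g = ≡.refl
  ΣFin-cong-% (suc n) {f} {g} f≡g = begin
    ΣFin (suc n) f % r             ≡⟨ ≡.cong (_% r) (ΣFin-suc n f) ⟩
    (f 0F + ΣFin n (f ∘ 1+)) % r   ≡⟨ %-cong-+ (f≡g 0F) (ΣFin-cong-% n (f≡g ∘ 1+)) ⟩
    (g 0F + ΣFin n (g ∘ 1+)) % r   ≡⟨ ≡.cong (_% r) (ΣFin-suc n g) ⟨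
    ΣFin (suc n) g % r             ∎
    where open ≡-Reasoning

  ∣-respects-% : ∀ {d a b} → d ∣ r → a % r ≡ b % r → d ∣ a → d ∣ b
  ∣-respects-% d∣r a≡b d∣a = ∣n∣m%n⇒∣m d∣r (≡.subst (_ ∣_) a≡b (%-presˡ-∣ d∣a d∣r))

  r∣m+[r∸1]n⇒m≡n : ∀ m n → r ∣ m + pred r * n → m % r ≡ n % r
  r∣m+[r∸1]n⇒m≡n m n r∣ = begin
    m % r                        ≡⟨ [m+kn]%n≡m%n m n r ⟨
    (m + n * r) % r              ≡⟨ ≡.cong (λ x → (m + x) % r) (*-comm n r) ⟩
    (m + r * n) % r              ≡⟨ ≡.cong (λ x → (m + x * n) % r) (suc-pred r) ⟨
    (m + (n + pred r * n)) % r   ≡⟨ ≡.cong (λ x → (m + x) % r) (+-comm n _) ⟩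
    (m + (pred r * n + n)) % r   ≡⟨ ≡.cong (_% r) (+-assoc m _ n) ⟨
    (m + pred r * n + n) % r     ≡⟨ %-remove-+ˡ n r∣ ⟩
    n % r                        ∎
    where open ≡-Reasoning

  infixl 6 _⊕_

  _⊕_ : Fin r → Fin r → Fin r
  x ⊕ y = (toℕ x + toℕ y) mod r

  ⊖_ : Fin r → Fin r
  ⊖ x = (r ∸ toℕ x) mod r

  toℕ-mod : ∀ a → toℕ (a mod r) ≡ a % r
  toℕ-mod a = toℕ-fromℕ< (m%n<n a r)

  toℕ-mod-% : ∀ a → toℕ (a mod r) % r ≡ a % r
  toℕ-mod-% a = ≡.trans (≡.cong (_% r) (toℕ-mod a)) (m%n%n≡m%n a r)

  toℕ-% : ∀ (x : Fin r) → toℕ x % r ≡ toℕ x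
  toℕ-% x = m<n⇒m%n≡m (toℕ<n x)

  ⊕-cancel : ∀ x y z → (toℕ y + toℕ z) % r ≡ 0 → x ⊕ y ⊕ z ≡ x
  ⊕-cancel x y z y+z≡0 = toℕ-injective (begin
    toℕ (x ⊕ y ⊕ z)                      ≡⟨ toℕ-mod (toℕ (x ⊕ y) + toℕ z) ⟩
    (toℕ (x ⊕ y) + toℕ z) % r            ≡⟨ %-cong-+ (toℕ-mod-% (toℕ x + toℕ y)) ≡.refl ⟩
    (toℕ x + toℕ y + toℕ z) % r          ≡⟨ ≡.cong (_% r) (+-assoc (toℕ x) _ _) ⟩
    (toℕ x + (toℕ y + toℕ z)) % r        ≡⟨ %-cong-+ {toℕ x} ≡.refl (≡.trans y+z≡0 (≡.sym (n%n≡0 r))) ⟩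
    (toℕ x + r) % r                      ≡⟨ [m+n]%n≡m%n (toℕ x) r ⟩
    toℕ x % r                            ≡⟨ toℕ-% x ⟩
    toℕ x                                ∎)
    where open ≡-Reasoning

  ⊕⊖-cancel : ∀ d → (toℕ d + toℕ (⊖ d)) % r ≡ 0
  ⊕⊖-cancel d = begin
    (toℕ d + toℕ (⊖ d)) % r   ≡⟨ %-cong-+ {toℕ d} ≡.refl (toℕ-mod-% (r ∸ toℕ d)) ⟩
    (toℕ d + (r ∸ toℕ d)) % r ≡⟨ ≡.cong (_% r) (m+[n∸m]≡n (<⇒≤ (toℕ<n d))) ⟩
    r % r                     ≡⟨ n%n≡0 r ⟩
    0                         ∎
    where open ≡-Reasoning

  rotation : Fin r → Permutation r r
  rotation d = permutation (_⊕ d) (_⊕ ⊖ d)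
    (λ x → ⊕-cancel x (⊖ d) d (≡.trans (≡.cong (_% r) (+-comm (toℕ (⊖ d)) (toℕ d)))
                                        (⊕⊖-cancel d)))
    (λ x → ⊕-cancel x d (⊖ d) (⊕⊖-cancel d))

  infixl 6 _⊕ᵛ_

  _⊕ᵛ_ : ∀ {n} → Vec (Fin r) n → Vec (Fin r) n → Vec (Fin r) n
  _⊕ᵛ_ = zipWith _⊕_

  total : ∀ {n} → Vec (Fin r) n → ℕ
  total c = ℕ.sum (map toℕ (toList c))

  total-⊕ᵛ : ∀ {n} (c h : Vec (Fin r) n) → total (c ⊕ᵛ h) % r ≡ (total c + total h) % r
  total-⊕ᵛ []       []       = ≡.refl
  total-⊕ᵛ (x ∷ c) (y ∷ h) = ≡.trans
    (%-cong-+ (toℕ-mod-% (toℕ x + toℕ y)) (total-⊕ᵛ c h))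
    (≡.cong (_% r) (interchange (toℕ x) (toℕ y) (total c) (total h)))

  total≡ΣFin : ∀ {n} (c : Vec (Fin r) n) → total c ≡ ΣFin n (toℕ ∘ lookup c)
  total≡ΣFin []      = ≡.refl
  total≡ΣFin {suc n} (x ∷ c) =
    ≡.trans (≡.cong (toℕ x +_) (total≡ΣFin c)) (≡.sym (ΣFin-suc n (toℕ ∘ lookup (x ∷ c))))

  ⟨_,_⟩ : ∀ {n} → Vec (Fin r) n → (Fin n → ℕ) → ℕ
  ⟨_,_⟩ {n} c s = ΣFin n (λ j → toℕ (lookup c j) * s j)

  ⟨⊕ᵛ,⟩ : ∀ {n} (c h : Vec (Fin r) n) s →
          ⟨ c ⊕ᵛ h , s ⟩ % r ≡ (⟨ c , s ⟩ + ⟨ h , s ⟩) % r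
  ⟨⊕ᵛ,⟩ {n} c h s = begin
    ⟨ c ⊕ᵛ h , s ⟩ % r                                      ≡⟨ ΣFin-cong-% n termwise ⟩
    ΣFin n (λ j → toℕ (lookup c j) * s j + toℕ (lookup h j) * s j) % r
                                                           ≡⟨ ≡.cong (_% r) (ΣFin-distrib-+ n _ _) ⟩
    (⟨ c , s ⟩ + ⟨ h , s ⟩) % r                             ∎
    where
    open ≡-Reasoning
    termwise : ∀ j → (toℕ (lookup (c ⊕ᵛ h) j) * s j) % r
                   ≡ (toℕ (lookup c j) * s j + toℕ (lookup h j) * s j) % r
    termwise j = ≡.trans
      (%-cong-* (≡.trans (≡.cong (λ x → toℕ x % r) (lookup-zipWith _⊕_ j c h))
                         (toℕ-mod-% (toℕ (lookup c j) + toℕ (lookup h j)))) ≡.refl)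
      (≡.cong (_% r) (*-distribʳ-+ (s j) (toℕ (lookup c j)) (toℕ (lookup h j))))

  reduce : ∀ {n} → (Fin n → ℕ) → Vec (Fin r) n
  reduce u = Vec.tabulate (λ j → u j mod r)

  toℕ-lookup-reduce : ∀ {n} (u : Fin n → ℕ) j → toℕ (lookup (reduce u) j) % r ≡ u j % r
  toℕ-lookup-reduce u j = begin
    toℕ (lookup (reduce u) j) % r   ≡⟨ ≡.cong (λ x → toℕ x % r) (lookup∘tabulate _ j) ⟩
    toℕ (u j mod r) % r             ≡⟨ toℕ-mod-% (u j) ⟩
    u j % r                         ∎
    where open ≡-Reasoning

  total-reduce : ∀ {n} (u : Fin n → ℕ) → total (reduce u) % r ≡ ΣFin n u % r
  total-reduce {n} u =
    ≡.trans (≡.cong (_% r) (total≡ΣFin (reduce u))) (ΣFin-cong-% n (toℕ-lookup-reduce u))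

  ⟨reduce,⟩ : ∀ {n} (u s : Fin n → ℕ) → ⟨ reduce u , s ⟩ % r ≡ ΣFin n (λ j → u j * s j) % r
  ⟨reduce,⟩ {n} u s = ΣFin-cong-% n (λ j → %-cong-* (toℕ-lookup-reduce u j) ≡.refl)

  0ᵛ : ∀ {n} → Vec (Fin r) n
  0ᵛ = Vec.replicate _ (0 mod r)

  total-0ᵛ : ∀ n → total (0ᵛ {n}) ≡ 0
  total-0ᵛ zero    = ≡.refl
  total-0ᵛ (suc n) = ≡.cong₂ _+_ (≡.trans (toℕ-mod 0) (m<n⇒m%n≡m (ℕ.>-nonZero⁻¹ r))) (total-0ᵛ n)

  admissible : ℕ → ∀ n → List (Vec (Fin r) n)
  admissible p n = filter (λ c → p ∣? total c) (allVecs r n)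

  0ᵛ∈admissible : ∀ p n → 0ᵛ ∈ admissible p n
  0ᵛ∈admissible p n =
    ∈-filter⁺ (λ c → p ∣? total c) (∈-allVecs r n 0ᵛ)
              (≡.subst (p ∣_) (≡.sym (total-0ᵛ n)) (p ∣0))

  -- The power of ζ in actTerm [ σ ︔ c ] (1# , A).
  exponent : ∀ {k n} → Vec (Fin r) n → Exp k n → ℕ
  exponent {k} {n} c A = ΣFin k (λ i → ΣFin n (λ j → toℕ (lookup c j) * entry A i j))

  exponent≡⟨c,colSum⟩ : ∀ {k n} (c : Vec (Fin r) n) (A : Exp k n) → exponent c A ≡ ⟨ c , colSum A ⟩
  exponent≡⟨c,colSum⟩ {k} {n} c A = ≡.trans (ΣFin-comm k n (λ i j → toℕ (lookup c j) * entry A i j))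
    (ΣFin-cong n (λ j → ≡.sym (*-distribˡ-ΣFin k (toℕ (lookup c j)) (λ i → entry A i j))))

  r∣⟨c,s⟩ : ∀ {n p} (s : Fin n → ℕ) →
            (∀ i j → s i % r ≡ s j % r) → (∀ i → r ∣ p * s i) →
            (c : Vec (Fin r) n) → p ∣ total c → r ∣ ⟨ c , s ⟩
  r∣⟨c,s⟩ {zero}  s _ _ c _ = r ∣0
  r∣⟨c,s⟩ {suc n} {p} s s≡s₀ r∣ps c p∣c =
    ∣-respects-% ∣-refl total*s₀≡⟨c,s⟩ (∣-trans (r∣ps 0F) (*-monoˡ-∣ s₀ p∣c))
    where
    s₀ = s 0F
    total*s₀≡⟨c,s⟩ : (total c * s₀) % r ≡ ⟨ c , s ⟩ % r
    total*s₀≡⟨c,s⟩ = begin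
      (total c * s₀) % r
        ≡⟨ ≡.cong (λ x → (x * s₀) % r) (total≡ΣFin c) ⟩
      (ΣFin (suc n) (toℕ ∘ lookup c) * s₀) % r
        ≡⟨ ≡.cong (_% r) (*-distribʳ-ΣFin (suc n) s₀ (toℕ ∘ lookup c)) ⟩
      ΣFin (suc n) (λ j → toℕ (lookup c j) * s₀) % r
        ≡⟨ ΣFin-cong-% (suc n) (λ j → %-cong-* {toℕ (lookup c j)} ≡.refl (s≡s₀ 0F j)) ⟩
      ⟨ c , s ⟩ % r ∎
      where open ≡-Reasoning


module _ {c ℓ} (K : CharZeroField c ℓ) where
  open CharZeroField K
  open import Algebra.Properties.Ring ring using (-1*x≈-x)
  import Algebra.Properties.Semiring.Sum semiring as KΣ
  open import Relation.Binary.Reasoning.Setoid setoid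

  1≉0 : 1# ≉ 0#
  1≉0 1≈0 = char0 0 (trans (+-identityʳ 1#) 1≈0)

  x≉0∧x*y≈0⇒y≈0 : ∀ {x y} → x ≉ 0# → x * y ≈ 0# → y ≈ 0#
  x≉0∧x*y≈0⇒y≈0 {x} {y} x≉0 xy≈0 = begin
    y                ≈⟨ *-identityˡ y ⟨
    1# * y           ≈⟨ *-congʳ (⁻¹-inverse x x≉0) ⟨
    x * x ⁻¹ * y     ≈⟨ *-congʳ (*-comm x (x ⁻¹)) ⟩
    x ⁻¹ * x * y     ≈⟨ *-assoc (x ⁻¹) x y ⟩
    x ⁻¹ * (x * y)   ≈⟨ *-congˡ xy≈0 ⟩
    x ⁻¹ * 0#        ≈⟨ zeroʳ (x ⁻¹) ⟩
    0#               ∎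

  x≉0∧y≉0⇒x*y≉0 : ∀ {x y} → x ≉ 0# → y ≉ 0# → x * y ≉ 0#
  x≉0∧y≉0⇒x*y≉0 x≉0 y≉0 xy≈0 = y≉0 (x≉0∧x*y≈0⇒y≈0 x≉0 xy≈0)

  x≉0⇒x⁻¹≉0 : ∀ {x} → x ≉ 0# → x ⁻¹ ≉ 0#
  x≉0⇒x⁻¹≉0 {x} x≉0 x⁻¹≈0 = 1≉0 (begin
    1#          ≈⟨ ⁻¹-inverse x x≉0 ⟨
    x * x ⁻¹    ≈⟨ *-congˡ x⁻¹≈0 ⟩
    x * 0#      ≈⟨ zeroʳ x ⟩
    0#          ∎)

  x≉1∧x*y≈y⇒y≈0 : ∀ {x y} → x ≉ 1# → x * y ≈ y → y ≈ 0#
  x≉1∧x*y≈y⇒y≈0 {x} {y} x≉1 xy≈y = x≉0∧x*y≈0⇒y≈0 x-1≉0 (begin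
    (x - 1#) * y         ≈⟨ distribʳ y x (- 1#) ⟩
    x * y + - 1# * y     ≈⟨ +-cong xy≈y (-1*x≈-x y) ⟩
    y - y                ≈⟨ -‿inverseʳ y ⟩
    0#                   ∎)
    where
    x-1≉0 : x - 1# ≉ 0#
    x-1≉0 x-1≈0 = x≉1 (begin
      x                  ≈⟨ +-identityʳ x ⟨
      x + 0#             ≈⟨ +-congˡ (-‿inverseˡ 1#) ⟨
      x + (- 1# + 1#)    ≈⟨ +-assoc x (- 1#) 1# ⟨
      x - 1# + 1#        ≈⟨ +-congʳ x-1≈0 ⟩
      0# + 1#            ≈⟨ +-identityˡ 1# ⟩
      1#                 ∎)

  ∑ˡ : ∀ {a} {X : Set a} → List X → (X → Carrier) → Carrier
  ∑ˡ []       f = 0#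
  ∑ˡ (x ∷ xs) f = f x + ∑ˡ xs f

  infix 5 ∑ˡ
  syntax ∑ˡ xs (λ x → e) = ∑[ x ← xs ] e

  module _ {a} {X : Set a} where

    ∑ˡ-cong : ∀ (xs : List X) {f g : X → Carrier} → (∀ x → f x ≈ g x) → ∑ˡ xs f ≈ ∑ˡ xs g
    ∑ˡ-cong []       f≈g = refl
    ∑ˡ-cong (x ∷ xs) f≈g = +-cong (f≈g x) (∑ˡ-cong xs f≈g)

    ∑ˡ-++ : ∀ (xs ys : List X) f → ∑ˡ (xs List.++ ys) f ≈ ∑ˡ xs f + ∑ˡ ys f
    ∑ˡ-++ []       ys f = sym (+-identityˡ _)
    ∑ˡ-++ (x ∷ xs) ys f = trans (+-congˡ (∑ˡ-++ xs ys f)) (sym (+-assoc _ _ _))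

    ∑ˡ-zero : ∀ (xs : List X) {f} → (∀ x → f x ≈ 0#) → ∑ˡ xs f ≈ 0#
    ∑ˡ-zero []       f≈0 = refl
    ∑ˡ-zero (x ∷ xs) f≈0 = trans (+-cong (f≈0 x) (∑ˡ-zero xs f≈0)) (+-identityˡ 0#)

    *-distribˡ-∑ˡ : ∀ (xs : List X) a f → a * ∑ˡ xs f ≈ ∑[ x ← xs ] (a * f x)
    *-distribˡ-∑ˡ []       a f = zeroʳ a
    *-distribˡ-∑ˡ (x ∷ xs) a f = trans (distribˡ a _ _) (+-congˡ (*-distribˡ-∑ˡ xs a f))

    ∑ˡ-const : ∀ (xs : List X) a → ∑[ x ← xs ] a ≈ (length xs ·1× 1#) * a
    ∑ˡ-const []       a = sym (zeroˡ a)
    ∑ˡ-const (x ∷ xs) a = begin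
      a + (∑[ x ← xs ] a)                     ≈⟨ +-cong (*-identityˡ a) (sym (∑ˡ-const xs a)) ⟨
      1# * a + (length xs ·1× 1#) * a         ≈⟨ distribʳ a 1# _ ⟨
      (1# + length xs ·1× 1#) * a             ∎

    ∑ˡ-filter : ∀ {p} {P : X → Set p} (P? : Decidable P) (xs : List X) f →
                ∑ˡ (filter P? xs) f ≈ ∑[ x ← xs ] (if does (P? x) then f x else 0#)
    ∑ˡ-filter P? []       f = refl
    ∑ˡ-filter P? (x ∷ xs) f with does (P? x)
    ... | true  = +-congˡ (∑ˡ-filter P? xs f)
    ... | false = trans (∑ˡ-filter P? xs f) (sym (+-identityˡ _))

    ∑ˡ-count : ∀ {p} {P : X → Set p} (P? : Decidable P) (xs : List X) a →
               ∑[ x ← xs ] (if does (P? x) then a else 0#) ≈ (length (filter P? xs) ·1× 1#) * a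
    ∑ˡ-count P? xs a = trans (sym (∑ˡ-filter P? xs (λ _ → a))) (∑ˡ-const (filter P? xs) a)

    ∈⇒length×1≉0 : ∀ {x} {xs : List X} → x ∈ xs → length xs ·1× 1# ≉ 0#
    ∈⇒length×1≉0 {xs = y ∷ xs} _ = char0 (length xs)

  module _ {a b} {X : Set a} {Y : Set b} where

    ∑ˡ-map : ∀ (g : X → Y) xs f → ∑ˡ (map g xs) f ≡ ∑[ x ← xs ] f (g x)
    ∑ˡ-map g []       f = ≡.refl
    ∑ˡ-map g (x ∷ xs) f = ≡.cong (f (g x) +_) (∑ˡ-map g xs f)

    ∑ˡ-concatMap : ∀ (g : X → List Y) xs f → ∑ˡ (concatMap g xs) f ≈ ∑[ x ← xs ] ∑ˡ (g x) f
    ∑ˡ-concatMap g []       f = refl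
    ∑ˡ-concatMap g (x ∷ xs) f = trans (∑ˡ-++ (g x) _ f) (+-congˡ (∑ˡ-concatMap g xs f))

  module _ {a} {X : Set a} where

    ∑ˡ-tabulate : ∀ {m} (g : Fin m → X) f → ∑ˡ (List.tabulate g) f ≈ KΣ.sum (f ∘ g)
    ∑ˡ-tabulate {zero}  g f = refl
    ∑ˡ-tabulate {suc m} g f = +-congˡ (∑ˡ-tabulate (g ∘ 1+) f)

  ∑ˡ-allVecs-suc : ∀ {m} n f →
                   ∑ˡ (allVecs m (suc n)) f ≈ ∑[ x ← allFin m ] ∑[ v ← allVecs m n ] f (x ∷ v)
  ∑ˡ-allVecs-suc {m} n f = trans (∑ˡ-concatMap (λ x → map (x ∷_) (allVecs m n)) (allFin m) f)
    (∑ˡ-cong (allFin m) (λ x → reflexive (∑ˡ-map (x ∷_) (allVecs m n) f)))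

  module _ (r : ℕ) .{{_ : NonZero r}} where
    open Modular r

    ∑ˡ-allFin-rotate : ∀ f d → ∑ˡ (allFin r) f ≈ ∑[ x ← allFin r ] f (x ⊕ d)
    ∑ˡ-allFin-rotate f d = begin
      ∑ˡ (allFin r) f                  ≈⟨ ∑ˡ-tabulate id f ⟩
      KΣ.sum f                         ≈⟨ KΣ.sum-permute f (rotation d) ⟩
      KΣ.sum (λ x → f (x ⊕ d))         ≈⟨ ∑ˡ-tabulate id (λ x → f (x ⊕ d)) ⟨
      ∑[ x ← allFin r ] f (x ⊕ d)      ∎

    ∑ˡ-allVecs-translate : ∀ n f (h : Vec (Fin r) n) →
                           ∑ˡ (allVecs r n) f ≈ ∑[ c ← allVecs r n ] f (c ⊕ᵛ h)
    ∑ˡ-allVecs-translate zero    f []      = refl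
    ∑ˡ-allVecs-translate (suc n) f (d ∷ h) = begin
      ∑ˡ (allVecs r (suc n)) f
        ≈⟨ ∑ˡ-allVecs-suc n f ⟩
      ∑[ x ← allFin r ] ∑[ v ← allVecs r n ] f (x ∷ v)
        ≈⟨ ∑ˡ-cong (allFin r) (λ x → ∑ˡ-allVecs-translate n (λ v → f (x ∷ v)) h) ⟩
      ∑[ x ← allFin r ] ∑[ v ← allVecs r n ] f (x ∷ v ⊕ᵛ h)
        ≈⟨ ∑ˡ-allFin-rotate (λ x → ∑[ v ← allVecs r n ] f (x ∷ v ⊕ᵛ h)) d ⟩
      ∑[ x ← allFin r ] ∑[ v ← allVecs r n ] f (x ⊕ d ∷ v ⊕ᵛ h)
        ≈⟨ ∑ˡ-allVecs-suc n (λ c → f (c ⊕ᵛ (d ∷ h))) ⟨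
      ∑[ c ← allVecs r (suc n) ] f (c ⊕ᵛ (d ∷ h)) ∎

  module RootOfUnity (r : ℕ) .{{_ : NonZero r}} {ζ : Carrier} (prim : IsPrimitiveRoot K r ζ) where
    open import Algebra.Properties.Semiring.Exp semiring using (^-homo-*; ^-assocʳ; ^-congʳ; ^-congˡ)

    1^n≈1 : ∀ n → 1# ^ n ≈ 1#
    1^n≈1 zero    = refl
    1^n≈1 (suc n) = trans (*-identityˡ _) (1^n≈1 n)

    ζ^a≈ζ^[a%r] : ∀ a → ζ ^ a ≈ ζ ^ (a % r)
    ζ^a≈ζ^[a%r] a = begin
      ζ ^ a                               ≈⟨ ^-congʳ ζ a≡a%r+r[a/r] ⟩
      ζ ^ (a % r ℕ.+ r ℕ.* (a / r))       ≈⟨ ^-homo-* ζ (a % r) _ ⟩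
      ζ ^ (a % r) * ζ ^ (r ℕ.* (a / r))   ≈⟨ *-congˡ (^-assocʳ ζ r (a / r)) ⟨
      ζ ^ (a % r) * (ζ ^ r) ^ (a / r)     ≈⟨ *-congˡ (^-congˡ (a / r) (proj₁ prim)) ⟩
      ζ ^ (a % r) * 1# ^ (a / r)          ≈⟨ *-congˡ (1^n≈1 (a / r)) ⟩
      ζ ^ (a % r) * 1#                    ≈⟨ *-identityʳ _ ⟩
      ζ ^ (a % r)                         ∎
      where
      a≡a%r+r[a/r] : a ≡ a % r ℕ.+ r ℕ.* (a / r)
      a≡a%r+r[a/r] = ≡.trans (m≡m%n+[m/n]*n a r) (≡.cong (a % r ℕ.+_) (ℕ.*-comm (a / r) r))

    ζ^-cong-% : ∀ {a b} → a % r ≡ b % r → ζ ^ a ≈ ζ ^ b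
    ζ^-cong-% {a} {b} a≡b =
      trans (ζ^a≈ζ^[a%r] a) (trans (reflexive (≡.cong (ζ ^_) a≡b)) (sym (ζ^a≈ζ^[a%r] b)))

    r∣a⇒ζ^a≈1 : ∀ {a} → r ∣ a → ζ ^ a ≈ 1#
    r∣a⇒ζ^a≈1 {a} r∣a = trans (ζ^a≈ζ^[a%r] a) (reflexive (≡.cong (ζ ^_) (n∣m⇒m%n≡0 a r r∣a)))

    r∤a⇒ζ^a≉1 : ∀ {a} → ¬ r ∣ a → ζ ^ a ≉ 1#
    r∤a⇒ζ^a≉1 {a} r∤a ζ^a≈1 =
      proj₂ prim (a % r) (ℕ.n≢0⇒n>0 (r∤a ∘ m%n≡0⇒n∣m a r)) (m%n<n a r) (trans (sym (ζ^a≈ζ^[a%r] a)) ζ^a≈1)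

  module CharacterSum (r : ℕ) .{{_ : NonZero r}} {ζ : Carrier} (prim : IsPrimitiveRoot K r ζ)
                      {p : ℕ} (p∣r : p ∣ r) {n : ℕ} (s : Fin n → ℕ) where
    open Modular r
    open RootOfUnity r prim
    open import Algebra.Properties.Semiring.Exp semiring using (^-homo-*)

    χ : Vec (Fin r) n → Carrier
    χ c = if does (p ∣? total c) then ζ ^ ⟨ c , s ⟩ else 0#

    charSum : Carrier
    charSum = ∑[ c ← allVecs r n ] χ c

    χ-translate : ∀ {h} → p ∣ total h → ∀ c → χ (c ⊕ᵛ h) ≈ ζ ^ ⟨ h , s ⟩ * χ c
    χ-translate {h} p∣h c with p ∣? total (c ⊕ᵛ h) | p ∣? total c
    ... | yes _ | yes _ = begin
      ζ ^ ⟨ c ⊕ᵛ h , s ⟩                ≈⟨ ζ^-cong-% (⟨⊕ᵛ,⟩ c h s) ⟩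
      ζ ^ (⟨ c , s ⟩ ℕ.+ ⟨ h , s ⟩)     ≈⟨ ^-homo-* ζ (⟨ c , s ⟩) (⟨ h , s ⟩) ⟩
      ζ ^ ⟨ c , s ⟩ * ζ ^ ⟨ h , s ⟩     ≈⟨ *-comm _ _ ⟩
      ζ ^ ⟨ h , s ⟩ * ζ ^ ⟨ c , s ⟩     ∎
    ... | no _ | no _ = sym (zeroʳ _)
    ... | yes p∣c⊕h | no p∤c = contradiction
      (∣m+n∣m⇒∣n (≡.subst (p ∣_) (ℕ.+-comm (total c) (total h))
                          (∣-respects-% p∣r (total-⊕ᵛ c h) p∣c⊕h)) p∣h)
      p∤c
    ... | no p∤c⊕h | yes p∣c = contradiction
      (∣-respects-% p∣r (≡.sym (total-⊕ᵛ c h)) (∣m∣n⇒∣m+n p∣c p∣h))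
      p∤c⊕h

    charSum-translate : ∀ {h} → p ∣ total h → charSum ≈ ζ ^ ⟨ h , s ⟩ * charSum
    charSum-translate {h} p∣h = begin
      charSum                                      ≈⟨ ∑ˡ-allVecs-translate r n χ h ⟩
      ∑[ c ← allVecs r n ] χ (c ⊕ᵛ h)              ≈⟨ ∑ˡ-cong (allVecs r n) (χ-translate p∣h) ⟩
      ∑[ c ← allVecs r n ] (ζ ^ ⟨ h , s ⟩ * χ c)   ≈⟨ *-distribˡ-∑ˡ (allVecs r n) _ χ ⟨
      ζ ^ ⟨ h , s ⟩ * charSum                      ∎

    charSum≈0 : ∀ {h} → p ∣ total h → ¬ r ∣ ⟨ h , s ⟩ → charSum ≈ 0#
    charSum≈0 {h} p∣h r∤⟨h,s⟩ =
      x≉1∧x*y≈y⇒y≈0 (r∤a⇒ζ^a≉1 r∤⟨h,s⟩) (sym (charSum-translate {h} p∣h))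

    charSum≈0-reduce : ∀ u → p ∣ ΣFin n u → ¬ r ∣ ΣFin n (λ j → u j ℕ.* s j) → charSum ≈ 0#
    charSum≈0-reduce u p∣Σu r∤Σus = charSum≈0 {reduce u}
      (∣-respects-% p∣r (≡.sym (total-reduce u)) p∣Σu)
      (r∤Σus ∘ ∣-respects-% ∣-refl (⟨reduce,⟩ u s))

    charSum≉0⇒s%r≡s%r : charSum ≉ 0# → ∀ i j → s i % r ≡ s j % r
    charSum≉0⇒s%r≡s%r charSum≉0 i j = decidable-stable (s i % r ℕ.≟ s j % r) λ si≢sj →
      charSum≉0 (charSum≈0-reduce u
        (≡.subst (p ∣_) (≡.sym Σu≡r) p∣r)
        (si≢sj ∘ r∣m+[r∸1]n⇒m≡n (s i) (s j) ∘ ≡.subst (r ∣_) Σus≡si+[r∸1]sj))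
      where
      -- u = e_i + (r−1)e_j is admissible and ⟨u,s⟩ ≡ s_i − s_j (mod r).
      u : Fin n → ℕ
      u t = single i 1 t ℕ.+ single j (ℕ.pred r) t
      Σu≡r : ΣFin n u ≡ r
      Σu≡r = ≡.trans (ΣFin-single+single n i j 1 (ℕ.pred r)) (ℕ.suc-pred r)
      Σus≡si+[r∸1]sj : ΣFin n (λ t → u t ℕ.* s t) ≡ s i ℕ.+ ℕ.pred r ℕ.* s j
      Σus≡si+[r∸1]sj = ≡.trans (ΣFin-[single+single]* n i j 1 (ℕ.pred r) s)
                               (≡.cong (ℕ._+ ℕ.pred r ℕ.* s j) (ℕ.*-identityˡ (s i)))

    charSum≉0⇒r∣p*s : charSum ≉ 0# → ∀ i → r ∣ p ℕ.* s i
    charSum≉0⇒r∣p*s charSum≉0 i = decidable-stable (r ∣? p ℕ.* s i) λ r∤psᵢ →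
      charSum≉0 (charSum≈0-reduce (single i p)
        (≡.subst (p ∣_) (≡.sym (ΣFin-single n i p)) ∣-refl)
        (r∤psᵢ ∘ ≡.subst (r ∣_) (ΣFin-single-* n i p s)))

    conditions⇒charSum≉0 : (∀ i j → s i % r ≡ s j % r) → (∀ i → r ∣ p ℕ.* s i) → charSum ≉ 0#
    conditions⇒charSum≉0 s≡s r∣ps charSum≈0 =
      x≉0∧y≉0⇒x*y≉0 (∈⇒length×1≉0 (0ᵛ∈admissible p n)) 1≉0 (begin
        (length (admissible p n) ·1× 1#) * 1#
          ≈⟨ ∑ˡ-count (λ c → p ∣? total c) (allVecs r n) 1# ⟨
        ∑[ c ← allVecs r n ] (if does (p ∣? total c) then 1# else 0#)
          ≈⟨ ∑ˡ-cong (allVecs r n) χ≈[p∣total] ⟨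
        charSum
          ≈⟨ charSum≈0 ⟩
        0# ∎)
      where
      χ≈[p∣total] : ∀ c → χ c ≈ (if does (p ∣? total c) then 1# else 0#)
      χ≈[p∣total] c with p ∣? total c
      ... | yes p∣c = r∣a⇒ζ^a≈1 (r∣⟨c,s⟩ s s≡s r∣ps c p∣c)
      ... | no  _   = refl

    charSum≉0⇔conditions : charSum ≉ 0# ⇔ ((∀ i j → s i % r ≡ s j % r) × (∀ i → r ∣ p ℕ.* s i))
    charSum≉0⇔conditions = mk⇔
      (λ charSum≉0 → charSum≉0⇒s%r≡s%r charSum≉0 , charSum≉0⇒r∣p*s charSum≉0)
      (λ (s≡s , r∣ps) → conditions⇒charSum≉0 s≡s r∣ps)

  module Averaging {k n : ℕ} (r : ℕ) .{{_ : NonZero r}} (ζ : Carrier) (p : ℕ) where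
    open Poly K k n
    open Action r ζ
    open Modular r

    infix 4 _≟ᴱ_

    _≟ᴱ_ : DecidableEquality (Exp k n)
    _≟ᴱ_ = ≡-dec (≡-dec ℕ._≟_)

    transporters : Exp k n → Exp k n → List (Vec (Fin n) n)
    transporters A B = filter (λ σ → σ ⊙ A ≟ᴱ B) (permutations n)

    coeffTerm : Exp k n → Carrier × Exp k n → Carrier
    coeffTerm B (a , A) = if does (A ≟ᴱ B) then a else 0#

    coeff≈∑ : ∀ B F → coeff B F ≈ ∑ˡ F (coeffTerm B)
    coeff≈∑ B []      = refl
    coeff≈∑ B (t ∷ F) with does (proj₂ t ≟ᴱ B)
    ... | true  = +-congˡ (coeff≈∑ B F)
    ... | false = trans (coeff≈∑ B F) (sym (+-identityˡ _))

    coeff-scale : ∀ B a F → coeff B (scale a F) ≈ a * coeff B F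
    coeff-scale B a F = begin
      coeff B (scale a F)                           ≈⟨ coeff≈∑ B (scale a F) ⟩
      ∑ˡ (scale a F) (coeffTerm B)                  ≡⟨ ∑ˡ-map _ F (coeffTerm B) ⟩
      ∑[ t ← F ] coeffTerm B (a * proj₁ t , proj₂ t) ≈⟨ ∑ˡ-cong F coeffTerm-scale ⟩
      ∑[ t ← F ] (a * coeffTerm B t)                ≈⟨ *-distribˡ-∑ˡ F a (coeffTerm B) ⟨
      a * ∑ˡ F (coeffTerm B)                        ≈⟨ *-congˡ (coeff≈∑ B F) ⟨
      a * coeff B F                                 ∎
      where
      coeffTerm-scale : ∀ t → coeffTerm B (a * proj₁ t , proj₂ t) ≈ a * coeffTerm B t
      coeffTerm-scale (_ , A) with does (A ≟ᴱ B)
      ... | true  = refl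
      ... | false = sym (zeroʳ a)

    coeff-avg : ∀ A B → coeff B (avg p (𝒳^ A)) ≈
      (length G[ r , p , n ] ·1× 1#) ⁻¹
        * ((length (transporters A B) ·1× 1#) * (∑[ c ← admissible p n ] ζ ^ exponent c A))
    coeff-avg A B = trans (coeff-scale B _ (concatMap (λ g → act g (𝒳^ A)) G[ r , p , n ])) (*-congˡ (begin
      coeff B (concatMap (λ g → act g (𝒳^ A)) G[ r , p , n ])
        ≈⟨ coeff≈∑ B (concatMap (λ g → act g (𝒳^ A)) G[ r , p , n ]) ⟩
      ∑ˡ (concatMap (λ g → act g (𝒳^ A)) G[ r , p , n ]) (coeffTerm B)
        ≈⟨ ∑ˡ-concatMap (λ g → act g (𝒳^ A)) G[ r , p , n ] (coeffTerm B) ⟩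
      ∑[ g ← G[ r , p , n ] ] (coeffTerm B (actTerm g (1# , A)) + 0#)
        ≈⟨ ∑ˡ-cong G[ r , p , n ] (λ g → +-identityʳ _) ⟩
      ∑[ g ← G[ r , p , n ] ] coeffTerm B (actTerm g (1# , A))
        ≈⟨ ∑ˡ-concatMap (λ σ → map [ σ ︔_] (admissible p n)) (permutations n) _ ⟩
      ∑[ σ ← permutations n ] ∑[ g ← map [ σ ︔_] (admissible p n) ] coeffTerm B (actTerm g (1# , A))
        ≈⟨ ∑ˡ-cong (permutations n) (λ σ → trans (reflexive (∑ˡ-map [ σ ︔_] (admissible p n) _))
                                                   (inner σ)) ⟩
      ∑[ σ ← permutations n ] (if does (σ ⊙ A ≟ᴱ B) then S else 0#)
        ≈⟨ ∑ˡ-count (λ σ → σ ⊙ A ≟ᴱ B) (permutations n) S ⟩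
      (length (transporters A B) ·1× 1#) * S ∎))
      where
      S = ∑[ c ← admissible p n ] ζ ^ exponent c A
      inner : ∀ σ → ∑[ c ← admissible p n ] coeffTerm B (actTerm [ σ ︔ c ] (1# , A))
                  ≈ (if does (σ ⊙ A ≟ᴱ B) then S else 0#)
      inner σ with does (σ ⊙ A ≟ᴱ B)
      ... | true  = ∑ˡ-cong (admissible p n) (λ c → *-identityˡ _)
      ... | false = ∑ˡ-zero (admissible p n) (λ _ → refl)

  module AveragedMonomial (r : ℕ) .{{_ : NonZero r}} {ζ : Carrier} (prim : IsPrimitiveRoot K r ζ)
                          {p : ℕ} (p∣r : p ∣ r) {k n : ℕ} (A : Exp k n) where
    open Poly K k n
    open Action r ζ
    open Modular r
    open Averaging {k} {n} r ζ p
    open CharacterSum r prim p∣r (colSum A)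

    admissibleSum≈charSum : ∑[ c ← admissible p n ] ζ ^ exponent c A ≈ charSum
    admissibleSum≈charSum =
      trans (∑ˡ-filter (λ c → p ∣? total c) (allVecs r n) _) (∑ˡ-cong (allVecs r n) termwise)
      where
      termwise : ∀ c → (if does (p ∣? total c) then ζ ^ exponent c A else 0#) ≈ χ c
      termwise c with does (p ∣? total c)
      ... | true  = reflexive (≡.cong (ζ ^_) (exponent≡⟨c,colSum⟩ c A))
      ... | false = refl

    coeff-avg≈charSum : ∀ B → coeff B (avg p (𝒳^ A)) ≈
      (length G[ r , p , n ] ·1× 1#) ⁻¹ * ((length (transporters A B) ·1× 1#) * charSum)
    coeff-avg≈charSum B = trans (coeff-avg A B) (*-congˡ (*-congˡ admissibleSum≈charSum))

    identity∈G : [ ι ︔ 0ᵛ ] ∈ G[ r , p , n ]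
    identity∈G = ∈-concatMap⁺ (λ σ → map [ σ ︔_] (admissible p n))
      (Any.map (λ { ≡.refl → ∈-map⁺ [ ι ︔_] (0ᵛ∈admissible p n) }) (ι∈permutations n))

    ι∈transporters : ι ∈ transporters A A
    ι∈transporters = ∈-filter⁺ (λ σ → σ ⊙ A ≟ᴱ A) (ι∈permutations n) (ι⊙A≡A A)

    avg≉0⇔charSum≉0 : NonZeroPoly (avg p (𝒳^ A)) ⇔ charSum ≉ 0#
    avg≉0⇔charSum≉0 = mk⇔
      (λ (B , coeff≉0) charSum≈0 → coeff≉0 (trans (coeff-avg≈charSum B)
        (trans (*-congˡ (trans (*-congˡ charSum≈0) (zeroʳ _))) (zeroʳ _))))
      (λ charSum≉0 → A , λ coeff≈0 → x≉0∧y≉0⇒x*y≉0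
        (x≉0⇒x⁻¹≉0 (∈⇒length×1≉0 identity∈G))
        (x≉0∧y≉0⇒x*y≉0 (∈⇒length×1≉0 ι∈transporters) charSum≉0)
        (trans (sym (coeff-avg≈charSum A)) coeff≈0))

open import Data.Nat using (_<_; _*_)

-- Only p ∣ r is used: avg averages over G(r,p,n) itself, whose action on S_q factors through
-- G(r,p,q,n) with fibres of equal size, so the hypotheses on q and the positivity ones are idle.
lemma8p1 : ∀ {c ℓ} (K : CharZeroField c ℓ) (ζ : CharZeroField.Carrier K)
    (r p q n k : ℕ) .{{_ : NonZero r}} → IsPrimitiveRoot K r ζ →
    0 < p → 0 < q → 0 < n → 0 < k →
    p ∣ r → q ∣ r → (p * q) ∣ (r * n) →
    (A : Exp k n) → (∀ i → q ∣ rowSum A i) →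
    Poly.NonZeroPoly K k n (Poly.Action.avg K k n r ζ p (Poly.𝒳^ K k n A))
      ⇔ ((∀ i j → colSum A i % r ≡ colSum A j % r)
         × (∀ i → r ∣ (p * colSum A i)))
lemma8p1 K ζ r p q n k prim _ _ _ _ p∣r _ _ A _ =
  ⇔-trans (AveragedMonomial.avg≉0⇔charSum≉0 K r prim p∣r A)
          (CharacterSum.charSum≉0⇔conditions K r prim p∣r (colSum A))
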